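{- Let $k\ge 3$ and let $\sigma=\sigma_1\cdots\sigma_{k-1}\sigma_k\in\mathfrak S_k$ satisfy $\sigma_{k-1}>\sigma_k$. Let $\pi$ be a permutation of length $n$ with left-to-right minima decomposition $\pi=m_1B_1m_2B_2\cdots m_tB_t$. Then: (1) Every time a left-to-right minimum $m_i$ is pushed into the $\{132,\sigma\}$-stack (during the greedy passing of $\pi$ through it), the stack contains (immediately before the push) exactly the elements $m_{i-1},\dots,m_2,m_1$, reading from top to bottom. Moreover $$\mathrm{out}^{132,\sigma}(\pi)=\tilde B_1\tilde B_2\cdots\tilde B_t\,m_t\cdots m_2m_1,$$ where each $\tilde B_i$ is a rearrangement of $B_i$. (2) If $\pi$ is $\{132,\sigma\}$-sortable, then each $\tilde B_i$ is decreasing, and for each $i\le t-1$ we have $B_i>B_{i+1}$, i.e. $x>y$ for all $x\in B_i$, $y\in B_{i+1}$.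
   Context: A permutation $\pi$ contains a pattern $\tau\in\mathfrak S_k$ if it has a subsequence order-isomorphic to $\tau$; otherwise it avoids $\tau$. For a set $T$ of patterns, a $T$-stack is a stack whose content, read from top to bottom, must never contain an occurrence of a pattern of $T$. A sequence $\pi$ of distinct integers is passed through the $T$-stack greedily: at each step, if the input is nonempty and placing its next element on top of the stack creates no occurrence of a pattern of $T$ in the stack (read top to bottom), that element is pushed; otherwise the top element of the stack is popped and appended to the output. The final output is denoted $\mathrm{out}^T(\pi)$ (for $T=\{\sigma,\tau\}$ write $\mathrm{out}^{\sigma,\tau}$). The $T$-machine consists of the $T$-stack followed by a $\{21\}$-stack (a classical stack, also operated greedily); $\pi$ is $T$-sortable if passing $\pi$ through the $T$-stack and then passing $\mathrm{out}^T(\pi)$ through the $\{21\}$-stack yields the increasing permutation. An entry $\pi_i$ is a left-to-right minimum if $\pi_i<\pi_j$ for all $j<i$. The left-to-right minima decomposition of $\pi$ is $\pi=m_1B_1\cdots m_tB_t$ where $m_1>\cdots>m_t$ are the left-to-right minima and $B_i$ is the (possibly empty) factor between $m_i$ and $m_{i+1}$ ($B_t$ is the factor after $m_t$). -}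

module Defs where

open import Data.Nat using (ℕ; zero; suc; _+_; _*_; _<_; _>_; _<ᵇ_)
open import Data.Bool using (Bool; true; false; _∧_; _∨_; not; if_then_else_)
open import Data.List using (List; []; _∷_; _++_; [_]; length; map; concatMap; zip; upTo)
open import Data.Product using (_×_; _,_; proj₁; proj₂)
open import Function using (_∘_)

subsequences : List ℕ → List (List ℕ)
subsequences [] = [] ∷ []
subsequences (x ∷ xs) = map (x ∷_) (subsequences xs) ++ subsequences xs

anyᵇ : {A : Set} → (A → Bool) → List A → Bool
anyᵇ p [] = false
anyᵇ p (x ∷ xs) = p x ∨ anyᵇ p xs

allᵇ : {A : Set} → (A → Bool) → List A → Bool
allᵇ p [] = true
allᵇ p (x ∷ xs) = p x ∧ allᵇ p xs

_==ᵇ_ : Bool → Bool → Bool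
true  ==ᵇ b = b
false ==ᵇ b = not b

orderIsoᵇ : List ℕ → List ℕ → Bool
orderIsoᵇ [] [] = true
orderIsoᵇ [] (_ ∷ _) = false
orderIsoᵇ (_ ∷ _) [] = false
orderIsoᵇ (x ∷ xs) (y ∷ ys) =
  allᵇ (λ p → ((x <ᵇ proj₁ p) ==ᵇ (y <ᵇ proj₂ p))
             ∧ ((proj₁ p <ᵇ x) ==ᵇ (proj₂ p <ᵇ y))) (zip xs ys)
  ∧ orderIsoᵇ xs ys

containsᵇ : List ℕ → List ℕ → Bool
containsᵇ π τ = anyᵇ (λ s → orderIsoᵇ s τ) (subsequences π)

containsSomeᵇ : List (List ℕ) → List ℕ → Bool
containsSomeᵇ T π = anyᵇ (containsᵇ π) T

-- The greedy T-stack.  Stacks are lists with the head being the top,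
-- so a stack read from top to bottom is the list itself.

record Config : Set where
  constructor conf
  field
    input  : List ℕ
    stack  : List ℕ
    output : List ℕ
open Config public

-- one step of the greedy algorithm.  (When the stack is empty and the
-- input nonempty we push; for T consisting of patterns of length ≥ 2
-- pushing onto the empty stack never creates an occurrence anyway.)
step : List (List ℕ) → Config → Config
step T (conf (x ∷ xs) [] out) = conf xs (x ∷ []) out
step T (conf (x ∷ xs) (y ∷ st) out) =
  if containsSomeᵇ T (x ∷ y ∷ st)
  then conf (x ∷ xs) st (out ++ [ y ])
  else conf xs (x ∷ y ∷ st) out
step T (conf [] (y ∷ st) out) = conf [] st (out ++ [ y ])
step T (conf [] [] out) = conf [] [] out

iterate : {A : Set} → (A → A) → ℕ → A → A
iterate f zero a = a
iterate f (suc n) a = f (iterate f n a)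

configAt : List (List ℕ) → List ℕ → ℕ → Config
configAt T π j = iterate (step T) j (conf π [] [])

-- out^T(π): every step decreases 2·|input| + |stack| by one until the
-- terminal configuration, so 2·|π| steps suffice.
out : List (List ℕ) → List ℕ → List ℕ
out T π = output (configAt T π (2 * length π))

-- the T-machine: T-stack followed by a classical {21}-stack
Sortable : List (List ℕ) → List ℕ → Set
Sortable T π = out (((2 ∷ 1 ∷ []) ∷ [])) (out T π) ≡ map suc (upTo (length π))
  where open import Relation.Binary.PropositionalEquality using (_≡_)

flatten : List (ℕ × List ℕ) → List ℕ
flatten = concatMap (λ p → proj₁ p ∷ proj₂ p)

open import Relation.Binary.PropositionalEquality using (_≡_)
open import Data.List.Relation.Unary.All using (All)
open import Data.List.Relation.Unary.Linked using (Linked)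

-- D = [(m_1,B_1), …, (m_t,B_t)] is the left-to-right minima decomposition
-- of π:  π = m_1 B_1 ⋯ m_t B_t,  m_1 > m_2 > ⋯ > m_t, and every entry of
-- B_i is larger than m_i.  (These conditions say precisely that the m_i
-- are the left-to-right minima of π and B_i the factor between m_i and
-- m_{i+1}.)
IsLTRMinDecomp : List ℕ → List (ℕ × List ℕ) → Set
IsLTRMinDecomp π D =
  (flatten D ≡ π)
  × Linked (λ p q → proj₁ p > proj₁ q) D
  × All (λ p → All (proj₁ p <_) (proj₂ p)) D

open import Data.List.Relation.Binary.Permutation.Propositional using (_↭_)
IsPerm : ℕ → List ℕ → Set
IsPerm n π = π ↭ map suc (upTo n)

module Submission where

-- Read top to bottom, the {132,σ}-stack always holds an increasing run of
-- left-to-right minima m_i ⋯ m_1, possibly topped by entries of the block B_i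
-- being read.  Pushing onto an increasing stack is never blocked, since after
-- their first letter both 132 and σ contain a descent (σ_{k-1} > σ_k).  When m_{i+1}
-- arrives, an entry y of B_i still above m_i would form 132 with m_{i+1} and
-- m_i, so the block is popped down to m_i before m_{i+1} is pushed.  The classical stack cannot sort a sequence
-- containing x ⋯ y ⋯ z with z < x < y, because y is never pushed onto x; as
-- m_t comes after all blocks and lies below all their entries, sortability
-- forces B̃_1 ⋯ B̃_t to be decreasing, which is part (2).

open import Defs
open import Data.Bool using (Bool; true; false)
open import Data.Bool.Properties using (¬-not; T-≡; ∧-conicalˡ; ∧-conicalʳ; ∨-zeroʳ)
open import Data.Empty using (⊥; ⊥-elim)
open import Data.Nat using (ℕ; zero; suc; _+_; _*_; _<_; _>_; _≤_; _<ᵇ_; z≤n; s≤s)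
open import Data.Nat.Properties
  using ( <⇒<ᵇ; <ᵇ⇒<; <⇒≱; <⇒≤; <⇒≢; <-cmp; <-trans; <-asym; <-irrefl; ≤-refl; ≤-trans; ≤-reflexive
        ; ≤-antisym; ≤-pred; ≤-<-trans; <-≤-trans; ≰⇒>; ≮⇒≥; n<1+n; m≤n+m; m≤n⇒m≤1+n
        ; +-identityʳ; +-suc; +-monoˡ-≤ )
open import Data.List using (List; []; _∷_; _++_; [_]; length; map; concat; reverse; take; drop; upTo; initLast; _∷ʳ′_)
open import Data.List.Properties
  using ( ++-assoc; ++-identityʳ; ++-identityˡ-unique; ++-conicalʳ; length-++; length-map; length-upTo
        ; map-++; reverse-++; concat-++ )
open import Data.List.Membership.Propositional using (_∈_)
open import Data.List.Membership.Propositional.Properties using (∈-++⁺ˡ; ∈-++⁺ʳ; ∈-++⁻; ∈-map⁺; ∈-map⁻)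
open import Data.List.Relation.Unary.Any using (here; there)
open import Data.List.Relation.Unary.All as All using (All; []; _∷_)
import Data.List.Relation.Unary.All.Properties as AllP
open import Data.List.Relation.Unary.AllPairs as AllPairs using (AllPairs; []; _∷_)
import Data.List.Relation.Unary.AllPairs.Properties as AllPairsP
open import Data.List.Relation.Unary.Linked as Linked using (Linked; []; [-]; _∷_)
open import Data.List.Relation.Unary.Linked.Properties using (AllPairs⇒Linked; Linked⇒AllPairs)
open import Data.List.Relation.Binary.Pointwise as Pointwise using (Pointwise; []; _∷_)
open import Data.List.Relation.Binary.Sublist.Propositional
  using (_⊆_; []; _∷_; _∷ʳ_; ⊆-refl; ⊆-trans; minimum; from∈; lookup)
open import Data.List.Relation.Binary.Sublist.Propositional.Properties using (All-resp-⊆; ++⁺; ++⁺ʳ)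
open import Data.List.Relation.Binary.Permutation.Propositional
  using (_↭_; ↭-refl; ↭-sym; ↭-trans; ↭-reflexive; ↭⇒↭ₛ)
open import Data.List.Relation.Binary.Permutation.Propositional.Properties
  using (shift; ++⁺ˡ; ↭-length; All-resp-↭)
import Data.List.Relation.Binary.Permutation.Propositional.Properties as Perm
import Data.List.Relation.Binary.Permutation.Setoid.Properties as PermSetoid
open import Data.Product using (Σ; ∃; _×_; _,_; proj₁; proj₂)
open import Data.Sum using (_⊎_; inj₁; inj₂)
open import Function using (_∘_; id; Equivalence)
open import Relation.Nullary using (¬_)
open import Relation.Binary.Definitions using (tri<; tri≈; tri>)
open import Relation.Binary.PropositionalEquality
  using (_≡_; _≢_; refl; sym; trans; cong; subst; setoid; module ≡-Reasoning)

<ᵇ-true : ∀ {m n} → m < n → (m <ᵇ n) ≡ true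
<ᵇ-true m<n = Equivalence.to T-≡ (<⇒<ᵇ m<n)

<ᵇ-false : ∀ {m n} → n ≤ m → (m <ᵇ n) ≡ false
<ᵇ-false {m} {n} n≤m = ¬-not (λ m<ᵇn → <⇒≱ (<ᵇ⇒< m n (Equivalence.from T-≡ m<ᵇn)) n≤m)

==ᵇ-true : ∀ a b → (a ==ᵇ b) ≡ true → a ≡ b
==ᵇ-true true  true  _ = refl
==ᵇ-true false false _ = refl

anyᵇ-sound : ∀ {A : Set} (p : A → Bool) xs → anyᵇ p xs ≡ true → ∃ λ x → x ∈ xs × p x ≡ true
anyᵇ-sound p (x ∷ xs) e with p x in px
... | true  = x , here refl , px
... | false = let y , y∈xs , py = anyᵇ-sound p xs e in y , there y∈xs , py

anyᵇ-complete : ∀ {A : Set} (p : A → Bool) {x xs} → x ∈ xs → p x ≡ true → anyᵇ p xs ≡ true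
anyᵇ-complete p (here refl) px rewrite px = refl
anyᵇ-complete p {xs = y ∷ _} (there x∈xs) px rewrite anyᵇ-complete p x∈xs px = ∨-zeroʳ (p y)

∈-subsequences⁻ : ∀ {s} L → s ∈ subsequences L → s ⊆ L
∈-subsequences⁻ [] (here refl) = []
∈-subsequences⁻ (x ∷ L) s∈ with ∈-++⁻ (map (x ∷_) (subsequences L)) s∈
... | inj₂ s∈rest = x ∷ʳ ∈-subsequences⁻ L s∈rest
... | inj₁ s∈map with ∈-map⁻ (x ∷_) s∈map
...   | t , t∈ , refl = refl ∷ ∈-subsequences⁻ L t∈

∈-subsequences⁺ : ∀ {s L} → s ⊆ L → s ∈ subsequences L
∈-subsequences⁺ [] = here refl
∈-subsequences⁺ (refl ∷ τ) = ∈-++⁺ˡ (∈-map⁺ (_ ∷_) (∈-subsequences⁺ τ))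
∈-subsequences⁺ (_∷ʳ_ {ys = L} x τ) = ∈-++⁺ʳ (map (x ∷_) (subsequences L)) (∈-subsequences⁺ τ)

containsᵇ-sound : ∀ L τ → containsᵇ L τ ≡ true → ∃ λ s → s ⊆ L × orderIsoᵇ s τ ≡ true
containsᵇ-sound L τ e =
  let s , s∈ , iso = anyᵇ-sound _ (subsequences L) e in s , ∈-subsequences⁻ L s∈ , iso

containsᵇ-complete : ∀ {s L} τ → s ⊆ L → orderIsoᵇ s τ ≡ true → containsᵇ L τ ≡ true
containsᵇ-complete τ s⊆L = anyᵇ-complete (λ s → orderIsoᵇ s τ) (∈-subsequences⁺ s⊆L)

AllPairs-resp-⊆ : ∀ {R : ℕ → ℕ → Set} {xs ys} → xs ⊆ ys → AllPairs R ys → AllPairs R xs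
AllPairs-resp-⊆ []         []       = []
AllPairs-resp-⊆ (refl ∷ τ) (r ∷ rs) = All-resp-⊆ τ r ∷ AllPairs-resp-⊆ τ rs
AllPairs-resp-⊆ (_ ∷ʳ τ)   (_ ∷ rs) = AllPairs-resp-⊆ τ rs

orderIsoᵇ-tail : ∀ x s u τ → orderIsoᵇ (x ∷ s) (u ∷ τ) ≡ true → orderIsoᵇ s τ ≡ true
orderIsoᵇ-tail x s u τ = ∧-conicalʳ _ _

orderIsoᵇ-head : ∀ x y s u v t → orderIsoᵇ (x ∷ y ∷ s) (u ∷ v ∷ t) ≡ true → (x <ᵇ y) ≡ (u <ᵇ v)
orderIsoᵇ-head x y s u v t e = ==ᵇ-true _ _ (∧-conicalˡ _ _ (∧-conicalˡ _ _ (∧-conicalˡ _ _ e)))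

orderIsoᵇ-increasing : ∀ s τ → orderIsoᵇ s τ ≡ true → AllPairs _<_ s → Linked _<_ τ
orderIsoᵇ-increasing []          []          _ _ = []
orderIsoᵇ-increasing (x ∷ [])    (u ∷ [])    _ _ = [-]
orderIsoᵇ-increasing (x ∷ y ∷ s) (u ∷ v ∷ t) e ((x<y ∷ _) ∷ inc) =
  <ᵇ⇒< u v (Equivalence.from T-≡ (trans (sym (orderIsoᵇ-head x y s u v t e)) (<ᵇ-true x<y)))
  ∷ orderIsoᵇ-increasing (y ∷ s) (v ∷ t) (orderIsoᵇ-tail x (y ∷ s) u (v ∷ t) e) inc

containsᵇ-cons-increasing : ∀ x L u τ → AllPairs _<_ L → ¬ Linked _<_ τ → containsᵇ (x ∷ L) (u ∷ τ) ≡ false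
containsᵇ-cons-increasing x L u τ inc τ≮ = ¬-not (refute ∘ containsᵇ-sound (x ∷ L) (u ∷ τ))
  where
  refute : ∃ (λ s → s ⊆ x ∷ L × orderIsoᵇ s (u ∷ τ) ≡ true) → ⊥
  refute (x ∷ s , refl ∷ s⊆L , iso) =
    τ≮ (orderIsoᵇ-increasing s τ (orderIsoᵇ-tail x s u τ iso) (AllPairs-resp-⊆ s⊆L inc))
  refute (s , _ ∷ʳ s⊆L , iso) =
    τ≮ (Linked.tail (orderIsoᵇ-increasing s (u ∷ τ) iso (AllPairs-resp-⊆ s⊆L inc)))

orderIsoᵇ-132 : ∀ {a b c} → a < b → a < c → c < b → orderIsoᵇ (a ∷ b ∷ c ∷ []) (1 ∷ 3 ∷ 2 ∷ []) ≡ true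
orderIsoᵇ-132 a<b a<c c<b
  rewrite <ᵇ-true a<b | <ᵇ-false (<⇒≤ a<b) | <ᵇ-true a<c | <ᵇ-false (<⇒≤ a<c)
        | <ᵇ-true c<b | <ᵇ-false (<⇒≤ c<b) = refl

orderIsoᵇ-21 : ∀ {x y} → x < y → orderIsoᵇ (y ∷ x ∷ []) (2 ∷ 1 ∷ []) ≡ true
orderIsoᵇ-21 x<y rewrite <ᵇ-true x<y | <ᵇ-false (<⇒≤ x<y) = refl

x∷xs≢xs : ∀ {A : Set} {x : A} xs → x ∷ xs ≢ xs
x∷xs≢xs xs e = <-irrefl (cong length (sym e)) ≤-refl

length-suffix : ∀ (xs ys : List ℕ) → length ys ≤ length (xs ++ ys)
length-suffix xs ys = ≤-trans (m≤n+m _ _) (≤-reflexive (sym (length-++ xs)))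

drop-length-++ : ∀ {A : Set} (xs : List A) {ys} → drop (length xs) (xs ++ ys) ≡ ys
drop-length-++ []       = refl
drop-length-++ (_ ∷ xs) = drop-length-++ xs

drop-suc-length-++ : ∀ {A : Set} (xs : List A) {y ys} → drop (suc (length xs)) (xs ++ y ∷ ys) ≡ ys
drop-suc-length-++ []       = refl
drop-suc-length-++ (_ ∷ xs) = drop-suc-length-++ xs

take-suc-length-++ : ∀ {A : Set} (xs : List A) {y ys} → take (suc (length xs)) (xs ++ y ∷ ys) ≡ xs ++ [ y ]
take-suc-length-++ []       = refl
take-suc-length-++ (x ∷ xs) = cong (x ∷_) (take-suc-length-++ xs)

reverse-map-snoc : ∀ {A B : Set} (f : A → B) xs x → reverse (map f (xs ++ [ x ])) ≡ f x ∷ reverse (map f xs)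
reverse-map-snoc f xs x = trans (cong reverse (map-++ f xs [ x ])) (reverse-++ (map f xs) [ f x ])

concat-snoc : ∀ (Bs : List (List ℕ)) B → concat (Bs ++ [ B ]) ≡ concat Bs ++ B
concat-snoc Bs B = trans (sym (concat-++ Bs [ B ])) (cong (concat Bs ++_) (++-identityʳ B))

All-middle : ∀ {A : Set} {P : A → Set} xs {x ys} → All P (xs ++ x ∷ ys) → P x
All-middle xs h = All.lookup h (∈-++⁺ʳ xs (here refl))

Linked-middle : ∀ {A : Set} {R : A → A → Set} xs {x y ys} → Linked R (xs ++ x ∷ y ∷ ys) → R x y
Linked-middle []       h = Linked.head h
Linked-middle (_ ∷ xs) h = Linked-middle xs (Linked.tail h)

AllPairs-++⁻ : ∀ {R : ℕ → ℕ → Set} xs {ys} → AllPairs R (xs ++ ys) →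
               AllPairs R xs × AllPairs R ys × All (λ x → All (R x) ys) xs
AllPairs-++⁻ []       h        = [] , h , []
AllPairs-++⁻ (x ∷ xs) (hx ∷ h) =
  let hxs , hys , cross = AllPairs-++⁻ xs h in
  AllP.++⁻ˡ xs hx ∷ hxs , hys , AllP.++⁻ʳ xs hx ∷ cross

output-snoc : ∀ X {O o : List ℕ} y → o ≡ X ++ O → o ++ [ y ] ≡ X ++ (O ++ [ y ])
output-snoc X {O} y refl = ++-assoc X O [ y ]

↭-push : ∀ O S {R B : List ℕ} x → O ++ S ++ x ∷ R ↭ B → O ++ (x ∷ S) ++ R ↭ B
↭-push O S {R} x p = ↭-trans (++⁺ˡ O (↭-sym (shift x S R))) p

↭-pop : ∀ O S {R B : List ℕ} y → O ++ (y ∷ S) ++ R ↭ B → (O ++ [ y ]) ++ S ++ R ↭ B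
↭-pop O S {R} y p = ↭-trans (↭-reflexive (++-assoc O [ y ] (S ++ R))) p

length-suffix-↭ : ∀ O S R {B : List ℕ} → O ++ S ++ R ↭ B → length R ≤ length B
length-suffix-↭ O S R p = ≤-trans (≤-trans (length-suffix S R) (length-suffix O (S ++ R))) (≤-reflexive (↭-length p))

concat-↭ : ∀ {Xs Ys : List (List ℕ)} → Pointwise _↭_ Xs Ys → concat Xs ↭ concat Ys
concat-↭ []       = ↭-refl
concat-↭ (p ∷ pw) = Perm.++⁺ p (concat-↭ pw)

sorted-upTo : ∀ n → AllPairs _<_ (map suc (upTo n))
sorted-upTo n = AllPairsP.map⁺ (AllPairsP.applyUpTo⁺₁ id n (λ i<j _ → s≤s i<j))

distinct-of-perm : ∀ {w} n → w ↭ map suc (upTo n) → AllPairs _≢_ w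
distinct-of-perm n p = PermSetoid.Unique-resp-↭ (setoid ℕ) (↭⇒↭ₛ (↭-sym p)) (AllPairs.map <⇒≢ (sorted-upTo n))

iterate-suc-front : ∀ {A : Set} (f : A → A) n a → iterate f (suc n) a ≡ iterate f n (f a)
iterate-suc-front f zero    a = refl
iterate-suc-front f (suc n) a = cong f (iterate-suc-front f n a)

push-decreases : ∀ a s → 2 * a + suc s < 2 * suc a + s
push-decreases a s rewrite +-suc a (a + 0) | +-suc (2 * a) s = ≤-refl

pop-decreases : ∀ a s → 2 * a + s < 2 * a + suc s
pop-decreases a s rewrite +-suc (2 * a) s = n<1+n _

module Greedy (T : List (List ℕ)) where

  data Step : Config → Config → Set where
    push-empty : ∀ {x i o} → Step (conf (x ∷ i) [] o) (conf i [ x ] o)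
    push       : ∀ {x i y s o} → containsSomeᵇ T (x ∷ y ∷ s) ≡ false →
                 Step (conf (x ∷ i) (y ∷ s) o) (conf i (x ∷ y ∷ s) o)
    pop        : ∀ {x i y s o} → containsSomeᵇ T (x ∷ y ∷ s) ≡ true →
                 Step (conf (x ∷ i) (y ∷ s) o) (conf (x ∷ i) s (o ++ [ y ]))
    flush      : ∀ {y s o} → Step (conf [] (y ∷ s) o) (conf [] s (o ++ [ y ]))
    halt       : ∀ {o} → Step (conf [] [] o) (conf [] [] o)

  step-Step : ∀ c → Step c (step T c)
  step-Step (conf (x ∷ i) [] o) = push-empty
  step-Step (conf (x ∷ i) (y ∷ s) o) with containsSomeᵇ T (x ∷ y ∷ s) in e
  ... | true  = pop e
  ... | false = push e
  step-Step (conf [] (y ∷ s) o) = flush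
  step-Step (conf [] [] o) = halt

  iterate-invariant : ∀ {P : Config → Set} → (∀ {c c′} → P c → Step c c′ → P c′) →
                      ∀ j {c} → P c → P (iterate (step T) j c)
  iterate-invariant preserve zero    p = p
  iterate-invariant preserve (suc j) p = preserve (iterate-invariant preserve j p) (step-Step _)

  Halted : Config → Set
  Halted c = input c ≡ [] × stack c ≡ []

  weight : Config → ℕ
  weight c = 2 * length (input c) + length (stack c)

  weight-step : ∀ {c c′ N} → Step c c′ → weight c ≤ suc N → weight c′ ≤ N
  weight-step {conf (_ ∷ i) s _} push-empty w≤ = ≤-pred (≤-trans (push-decreases (length i) (length s)) w≤)
  weight-step {conf (_ ∷ i) s _} (push _)   w≤ = ≤-pred (≤-trans (push-decreases (length i) (length s)) w≤)
  weight-step {conf i (_ ∷ s) _} (pop _)    w≤ = ≤-pred (≤-trans (pop-decreases (length i) (length s)) w≤)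
  weight-step {conf i (_ ∷ s) _} flush      w≤ = ≤-pred (≤-trans (pop-decreases (length i) (length s)) w≤)
  weight-step halt _ = z≤n

  halts : ∀ N c → weight c ≤ N → Halted (iterate (step T) N c)
  halts zero    (conf [] [] _) _ = refl , refl
  halts (suc N) c w≤ rewrite iterate-suc-front (step T) N c = halts N (step T c) (weight-step (step-Step c) w≤)

  out-halted : ∀ π → Halted (configAt T π (2 * length π))
  out-halted π = halts (2 * length π) (conf π [] []) (≤-reflexive (+-identityʳ _))

  Conserves : List ℕ → Config → Set
  Conserves π c = output c ++ stack c ++ input c ↭ π

  conserves-step : ∀ {π c c′} → Conserves π c → Step c c′ → Conserves π c′
  conserves-step p push-empty = p
  conserves-step {c = conf (x ∷ i) s o} p (push _) = ↭-trans (++⁺ˡ o (↭-sym (shift x s i))) p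
  conserves-step {c = conf i (y ∷ s) o} p (pop _)  = ↭-trans (↭-reflexive (++-assoc o [ y ] (s ++ i))) p
  conserves-step {c = conf i (y ∷ s) o} p flush    = ↭-trans (↭-reflexive (++-assoc o [ y ] (s ++ i))) p
  conserves-step p halt = p

  out-↭ : ∀ π → out T π ↭ π
  out-↭ π with out-halted π | iterate-invariant {Conserves π} conserves-step (2 * length π) {conf π [] []} ↭-refl
  ... | i≡[] , s≡[] | p rewrite i≡[] | s≡[] = ↭-trans (↭-reflexive (sym (++-identityʳ _))) p

T21 : List (List ℕ)
T21 = (2 ∷ 1 ∷ []) ∷ []

sortable⇒out21-sorted : ∀ T π → Sortable T π → AllPairs _<_ (out T21 (out T π))
sortable⇒out21-sorted T π sortable = subst (AllPairs _<_) (sym sortable) (sorted-upTo (length π))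

contains-21 : ∀ {x y} s → x ∈ s → x < y → containsSomeᵇ T21 (y ∷ s) ≡ true
contains-21 s x∈s x<y = anyᵇ-complete (containsᵇ (_ ∷ s)) {xs = T21} (here refl)
  (containsᵇ-complete (2 ∷ 1 ∷ []) (refl ∷ from∈ x∈s) (orderIsoᵇ-21 x<y))

module _ {x y z : ℕ} (z<x : z < x) (x<y : x < y) where
  open Greedy T21

  data Stage231 : Config → Set where
    x-unread  : ∀ {i s o} → x ∷ y ∷ z ∷ [] ⊆ i → Stage231 (conf i s o)
    x-stacked : ∀ {i s o} → x ∈ s → y ∷ z ∷ [] ⊆ i → Stage231 (conf i s o)
    x-output  : ∀ {i s o} → x ∈ o → z ∈ s ⊎ z ∈ i → Stage231 (conf i s o)
    x-then-z  : ∀ {i s o} → x ∷ z ∷ [] ⊆ o → Stage231 (conf i s o)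

  stage-push : ∀ {t i s o} → s ≡ [] ⊎ containsSomeᵇ T21 (t ∷ s) ≡ false →
               Stage231 (conf (t ∷ i) s o) → Stage231 (conf i (t ∷ s) o)
  stage-push _ (x-unread (refl ∷ τ)) = x-stacked (here refl) τ
  stage-push _ (x-unread (_ ∷ʳ τ))   = x-unread τ
  stage-push (inj₁ refl) (x-stacked () _)
  stage-push (inj₂ allowed) (x-stacked x∈s (refl ∷ _)) with () ← trans (sym allowed) (contains-21 _ x∈s x<y)
  stage-push _ (x-stacked x∈s (_ ∷ʳ τ))           = x-stacked (there x∈s) τ
  stage-push _ (x-output x∈o (inj₁ z∈s))         = x-output x∈o (inj₁ (there z∈s))
  stage-push _ (x-output x∈o (inj₂ (here refl))) = x-output x∈o (inj₁ (here refl))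
  stage-push _ (x-output x∈o (inj₂ (there z∈i))) = x-output x∈o (inj₂ z∈i)
  stage-push _ (x-then-z τ) = x-then-z τ

  stage-pop : ∀ {t i s o} → Stage231 (conf i (t ∷ s) o) → Stage231 (conf i s (o ++ [ t ]))
  stage-pop (x-unread τ) = x-unread τ
  stage-pop {o = o} (x-stacked (here refl) τ) = x-output (∈-++⁺ʳ o (here refl)) (inj₂ (lookup τ (there (here refl))))
  stage-pop (x-stacked (there x∈s) τ)         = x-stacked x∈s τ
  stage-pop (x-output x∈o (inj₁ (here refl)))  = x-then-z (++⁺ (from∈ x∈o) ⊆-refl)
  stage-pop (x-output x∈o (inj₁ (there z∈s))) = x-output (∈-++⁺ˡ x∈o) (inj₁ z∈s)
  stage-pop (x-output x∈o (inj₂ z∈i))         = x-output (∈-++⁺ˡ x∈o) (inj₂ z∈i)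
  stage-pop {t = t} (x-then-z τ) = x-then-z (++⁺ʳ [ t ] τ)

  stage-step : ∀ {c c′} → Stage231 c → Step c c′ → Stage231 c′
  stage-step st push-empty     = stage-push (inj₁ refl) st
  stage-step st (push allowed) = stage-push (inj₂ allowed) st
  stage-step st (pop _)        = stage-pop st
  stage-step st flush          = stage-pop st
  stage-step st halt           = st

  stage-halted : ∀ {c} → Stage231 c → Halted c → ¬ AllPairs _<_ (output c)
  stage-halted (x-unread ())          (refl , refl)
  stage-halted (x-stacked () _)       (refl , refl)
  stage-halted (x-output _ (inj₁ ())) (refl , refl)
  stage-halted (x-output _ (inj₂ ())) (refl , refl)
  stage-halted (x-then-z τ) _ sorted with AllPairs-resp-⊆ τ sorted
  ... | (x<z ∷ []) ∷ _ = <-asym x<z z<x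

  231⇒out21-unsorted : ∀ {w} → x ∷ y ∷ z ∷ [] ⊆ w → ¬ AllPairs _<_ (out T21 w)
  231⇒out21-unsorted {w} τ = stage-halted (iterate-invariant stage-step (2 * length w) (x-unread τ)) (out-halted w)

decreasing-before-smaller : ∀ {w z} A → AllPairs _≢_ w → AllPairs _<_ (out T21 w) → A ++ [ z ] ⊆ w →
                            All (z <_) A → AllPairs _>_ A
decreasing-before-smaller [] _ _ _ [] = []
decreasing-before-smaller {w} {z} (x ∷ A) distinct sorted τ (z<x ∷ z<A) =
  All.tabulate above ∷ decreasing-before-smaller A distinct sorted (⊆-trans (x ∷ʳ ⊆-refl) τ) z<A
  where
  above : ∀ {y} → y ∈ A → x > y
  above {y} y∈A with <-cmp x y | ⊆-trans (refl ∷ ++⁺ (from∈ y∈A) ⊆-refl) τ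
  ... | tri< x<y _ _ | xyz = ⊥-elim (231⇒out21-unsorted z<x x<y xyz sorted)
  ... | tri≈ _ x≡y _ | xyz with (x≢y ∷ _) ∷ _ ← AllPairs-resp-⊆ xyz distinct = ⊥-elim (x≢y x≡y)
  ... | tri> _ _ y<x | _ = y<x

Above : List ℕ → List ℕ → Set
Above B B′ = All (λ x → All (λ y → x > y) B′) B

Above-resp-↭ : ∀ {B₁ B₂ B₁′ B₂′} → B₁ ↭ B₂ → B₁′ ↭ B₂′ → Above B₁ B₁′ → Above B₂ B₂′
Above-resp-↭ p q h = All-resp-↭ p (All.map (All-resp-↭ q) h)

Linked-Above-resp-↭ : ∀ {Xs Ys} → Pointwise _↭_ Xs Ys → Linked Above Xs → Linked Above Ys
Linked-Above-resp-↭ []           []      = []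
Linked-Above-resp-↭ (p ∷ [])     [-]     = [-]
Linked-Above-resp-↭ (p ∷ q ∷ pw) (h ∷ l) = Above-resp-↭ p q h ∷ Linked-Above-resp-↭ (q ∷ pw) l

decreasing-concat⁻ : ∀ Bs → AllPairs _>_ (concat Bs) → All (AllPairs _>_) Bs × AllPairs Above Bs
decreasing-concat⁻ []       _ = [] , []
decreasing-concat⁻ (B ∷ Bs) h =
  let hB , hBs , cross = AllPairs-++⁻ B h
      dec , above = decreasing-concat⁻ Bs hBs in
  hB ∷ dec , All.tabulate (λ B′∈Bs → All.map (λ x>Bs → All.lookup (AllP.concat⁻ x>Bs) B′∈Bs) cross) ∷ above

MinsDecreasing : List (ℕ × List ℕ) → Set
MinsDecreasing = Linked (λ p q → proj₁ p > proj₁ q)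

BlocksAboveMins : List (ℕ × List ℕ) → Set
BlocksAboveMins = All (λ p → All (proj₁ p <_) (proj₂ p))

last-min-below-blocks : ∀ D₀ {m B} → AllPairs (λ p q → proj₁ p > proj₁ q) (D₀ ++ [ (m , B) ]) →
                        BlocksAboveMins (D₀ ++ [ (m , B) ]) → All (m <_) (concat (map proj₂ (D₀ ++ [ (m , B) ])))
last-min-below-blocks []       _              (B>m ∷ [])   = AllP.++⁺ B>m []
last-min-below-blocks (p ∷ D₀) (p>rest ∷ ap) (Bp>p ∷ hs) =
  AllP.++⁺ (All.map (<-trans (All-middle D₀ p>rest)) Bp>p) (last-min-below-blocks D₀ ap hs)

sorted-out21⇒blocks-decreasing :
  ∀ D {Bt w} → MinsDecreasing D → BlocksAboveMins D → Pointwise _↭_ Bt (map proj₂ D) →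
  w ≡ concat Bt ++ reverse (map proj₁ D) → AllPairs _≢_ w → AllPairs _<_ (out T21 w) →
  All (Linked _>_) Bt × Linked Above (map proj₂ D)
sorted-out21⇒blocks-decreasing D mins blocks pw w≡ distinct sorted with initLast D
sorted-out21⇒blocks-decreasing .[] _ _ [] _ _ _ | [] = [] , []
sorted-out21⇒blocks-decreasing .(D₀ ++ [ (m , B) ]) {Bt} mins blocks pw w≡ distinct sorted | D₀ ∷ʳ′ (m , B) =
  All.map AllPairs⇒Linked (proj₁ split) , Linked-Above-resp-↭ pw (AllPairs⇒Linked (proj₂ split))
  where
  m<Bt : All (m <_) (concat Bt)
  m<Bt = All-resp-↭ (↭-sym (concat-↭ pw))
           (last-min-below-blocks D₀ (Linked⇒AllPairs (λ q<p r<q → <-trans r<q q<p) mins) blocks)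
  Bt-then-m : concat Bt ++ [ m ] ⊆ _
  Bt-then-m = subst (concat Bt ++ [ m ] ⊆_) (sym (trans w≡ (cong (concat Bt ++_) (reverse-map-snoc proj₁ D₀ (m , B)))))
                    (++⁺ ⊆-refl (refl ∷ minimum _))
  split : All (AllPairs _>_) Bt × AllPairs Above Bt
  split = decreasing-concat⁻ Bt (decreasing-before-smaller (concat Bt) distinct sorted Bt-then-m m<Bt)

flatten-∷ : ∀ Δ {x i} → x ∷ i ≡ flatten Δ → ∃ λ B → ∃ λ post → Δ ≡ (x , B) ∷ post × i ≡ B ++ flatten post
flatten-∷ ((m , B) ∷ post) refl = B , post , refl , refl

flatten-≡[] : ∀ Δ → [] ≡ flatten Δ → Δ ≡ []
flatten-≡[] [] _ = refl

flatten-drop-≢[] : ∀ Δ {i} → i < length Δ → flatten (drop i Δ) ≢ []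
flatten-drop-≢[] (_ ∷ Δ) {suc i} (s≤s i<) = flatten-drop-≢[] Δ i<

length-flatten-drop-antitone : ∀ Δ {i j} → i ≤ j → length (flatten (drop j Δ)) ≤ length (flatten (drop i Δ))
length-flatten-drop-antitone Δ       {zero}  {zero}  _         = ≤-refl
length-flatten-drop-antitone []      {zero}  {suc j} _         = z≤n
length-flatten-drop-antitone (d ∷ Δ) {zero}  {suc j} _         =
  ≤-trans (length-flatten-drop-antitone Δ {zero} {j} z≤n) (m≤n⇒m≤1+n (length-suffix (proj₂ d) (flatten Δ)))
length-flatten-drop-antitone []      {suc i} {suc j} _         = ≤-refl
length-flatten-drop-antitone (d ∷ Δ) {suc i} {suc j} (s≤s i≤j) = length-flatten-drop-antitone Δ i≤j

length-flatten-drop-suc : ∀ Δ {i} → i < length Δ → length (flatten (drop (suc i) Δ)) < length (flatten (drop i Δ))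
length-flatten-drop-suc (d ∷ Δ) {zero}  _        = s≤s (length-suffix (proj₂ d) (flatten Δ))
length-flatten-drop-suc (d ∷ Δ) {suc i} (s≤s i<) = length-flatten-drop-suc Δ i<

length-flatten-drop-decreasing : ∀ Δ {i j} → i < j → j ≤ length Δ →
                                 length (flatten (drop j Δ)) < length (flatten (drop i Δ))
length-flatten-drop-decreasing Δ i<j j≤ =
  ≤-<-trans (length-flatten-drop-antitone Δ i<j) (length-flatten-drop-suc Δ (<-≤-trans i<j j≤))

block-boundary : ∀ {Δ pre m B post R} i → Δ ≡ pre ++ (m , B) ∷ post → length R ≤ length B → i ≤ length Δ →
                 R ++ flatten post ≡ flatten (drop i Δ) → i ≡ suc (length pre) × R ≡ []
block-boundary {Δ} {pre} {m} {B} {post} {R} i refl R≤B i≤Δ e = i≡ , R≡[]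
  where
  p = length pre
  n : ℕ → ℕ
  n k = length (flatten (drop k Δ))
  nᵢ≡ : n i ≡ length (R ++ flatten post)
  nᵢ≡ = cong length (sym e)
  nᵢ<nₚ : n i < n p
  nᵢ<nₚ rewrite nᵢ≡ | drop-length-++ pre {(m , B) ∷ post} | length-++ R {flatten post} | length-++ B {flatten post} =
    s≤s (+-monoˡ-≤ _ R≤B)
  nₚ₊₁≤nᵢ : n (suc p) ≤ n i
  nₚ₊₁≤nᵢ rewrite nᵢ≡ | drop-suc-length-++ pre {m , B} {post} = length-suffix R (flatten post)
  i≡ : i ≡ suc p
  i≡ = ≤-antisym
    (≮⇒≥ (λ p₊₁<i → <-irrefl refl (<-≤-trans (length-flatten-drop-decreasing Δ p₊₁<i i≤Δ) nₚ₊₁≤nᵢ)))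
    (≰⇒> (λ i≤p → <-irrefl refl (≤-<-trans (length-flatten-drop-antitone Δ i≤p) nᵢ<nₚ)))
  R≡[] : R ≡ []
  R≡[] = ++-identityˡ-unique R
    (sym (trans e (trans (cong (λ k → flatten (drop k Δ)) i≡) (cong flatten (drop-suc-length-++ pre)))))

module PatternStack (u : ℕ) (τ : List ℕ) (τ-not-increasing : ¬ Linked _<_ τ) where

  T : List (List ℕ)
  T = (1 ∷ 3 ∷ 2 ∷ []) ∷ (u ∷ τ) ∷ []

  open Greedy T public

  push-onto-increasing : ∀ x {L} → AllPairs _<_ L → containsSomeᵇ T (x ∷ L) ≡ false
  push-onto-increasing x {L} inc
    rewrite containsᵇ-cons-increasing x L 1 (3 ∷ 2 ∷ []) inc (λ { (s≤s (s≤s ()) ∷ _) })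
          | containsᵇ-cons-increasing x L u τ inc τ-not-increasing = refl

  push-blocked-by-132 : ∀ {m′ y m} S M → m′ < m → m < y → containsSomeᵇ T (m′ ∷ y ∷ S ++ m ∷ M) ≡ true
  push-blocked-by-132 {m′} {y} {m} S M m′<m m<y =
    anyᵇ-complete (containsᵇ (m′ ∷ y ∷ S ++ m ∷ M)) {xs = T} (here refl)
      (containsᵇ-complete (1 ∷ 3 ∷ 2 ∷ []) (refl ∷ refl ∷ from∈ (∈-++⁺ʳ S (here refl)))
         (orderIsoᵇ-132 (<-trans m′<m m<y) m′<m m<y))

  module Run (D : List (ℕ × List ℕ)) (mins-decreasing : MinsDecreasing D) (blocks-above-mins : BlocksAboveMins D) where

    record InBlock (pre post : List (ℕ × List ℕ)) (m : ℕ) (B : List ℕ) (Bt : List (List ℕ)) (M : List ℕ) : Set where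
      field
        splits          : D ≡ pre ++ (m , B) ∷ post
        earlier-mins    : M ≡ reverse (map proj₁ pre)
        mins-increasing : AllPairs _<_ (m ∷ M)
        earlier-blocks  : Pointwise _↭_ Bt (map proj₂ pre)
    open InBlock

    -- While the block (m , B) is read, B is split into O (already output),
    -- S (on the stack above m) and R (still unread).
    data Inv : Config → Set where
      start    : ∀ {i} → i ≡ flatten D → Inv (conf i [] [])
      reading  : ∀ {pre post m B Bt M O S R o} → InBlock pre post m B Bt M →
                 o ≡ concat Bt ++ O → O ++ S ++ R ↭ B → All (m <_) S → All (m <_) R →
                 Inv (conf (R ++ flatten post) (S ++ m ∷ M) o)
      flushing : ∀ {Bt P s o} → Pointwise _↭_ Bt (map proj₂ D) →
                 reverse (map proj₁ D) ≡ P ++ s → o ≡ concat Bt ++ P → Inv (conf [] s o)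

    block-above-min : ∀ {pre post m B} → D ≡ pre ++ (m , B) ∷ post → All (m <_) B
    block-above-min {pre} D≡ = All-middle pre (subst BlocksAboveMins D≡ blocks-above-mins)

    next-min-smaller : ∀ {pre post m B m′ B′} → D ≡ pre ++ (m , B) ∷ (m′ , B′) ∷ post → m′ < m
    next-min-smaller {pre} D≡ = Linked-middle pre (subst MinsDecreasing D≡ mins-decreasing)

    blocks-snoc : ∀ {pre post m B Bt M O} → InBlock pre post m B Bt M → O ++ [] ↭ B →
                  Pointwise _↭_ (Bt ++ [ O ]) (map proj₂ (pre ++ [ (m , B) ]))
    blocks-snoc {pre} {m = m} {B} {O = O} blk O↭B =
      subst (Pointwise _↭_ _) (sym (map-++ proj₂ pre [ (m , B) ]))
        (Pointwise.++⁺ (earlier-blocks blk) (↭-trans (↭-reflexive (sym (++-identityʳ O))) O↭B ∷ []))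

    begin-reading : ∀ {x i} → x ∷ i ≡ flatten D → Inv (conf i [ x ] [])
    begin-reading e with flatten-∷ D e
    ... | B , post , D≡ , refl = reading blk refl ↭-refl [] (block-above-min {pre = []} D≡)
      where
      blk : InBlock [] post _ B [] []
      blk = record { splits = D≡ ; earlier-mins = refl ; mins-increasing = [] ∷ [] ; earlier-blocks = [] }

    next-block : ∀ {pre post m B m′ B′ Bt M O o} → InBlock pre ((m′ , B′) ∷ post) m B Bt M →
                 o ≡ concat Bt ++ O → O ++ [] ↭ B → Inv (conf (B′ ++ flatten post) (m′ ∷ m ∷ M) o)
    next-block {pre} {post} {m} {B} {m′} {B′} {Bt} {M} {O} blk eo O↭B =
      reading blk′ (trans eo (sym (trans (++-identityʳ _) (concat-snoc Bt O)))) ↭-refl [] (block-above-min (splits blk′))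
      where
      m′<m : m′ < m
      m′<m = next-min-smaller (splits blk)
      blk′ : InBlock (pre ++ [ (m , B) ]) post m′ B′ (Bt ++ [ O ]) (m ∷ M)
      blk′ = record
        { splits          = trans (splits blk) (sym (++-assoc pre [ (m , B) ] ((m′ , B′) ∷ post)))
        ; earlier-mins    = trans (cong (m ∷_) (earlier-mins blk)) (sym (reverse-map-snoc proj₁ pre (m , B)))
        ; mins-increasing = (m′<m ∷ All.map (<-trans m′<m) (AllPairs.head (mins-increasing blk))) ∷ mins-increasing blk
        ; earlier-blocks  = blocks-snoc blk O↭B
        }

    finish : ∀ {pre m B Bt M O o} → InBlock pre [] m B Bt M →
             o ≡ concat Bt ++ O → O ++ [] ↭ B → Inv (conf [] M (o ++ [ m ]))
    finish {pre} {m} {B} {Bt} {O = O} blk eo O↭B =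
      flushing (subst (λ Δ → Pointwise _↭_ _ (map proj₂ Δ)) (sym (splits blk)) (blocks-snoc blk O↭B))
               (trans (cong (reverse ∘ map proj₁) (splits blk))
                      (trans (reverse-map-snoc proj₁ pre (m , B)) (cong (m ∷_) (sym (earlier-mins blk)))))
               (cong (_++ [ m ]) (trans eo (sym (concat-snoc Bt O))))

    inv-step : ∀ {c c′} → Inv c → Step c c′ → Inv c′
    inv-step (start e) push-empty = begin-reading e
    inv-step (start e) halt       = start e
    inv-step (reading {O = O} {S = []} {R = x ∷ R} blk eo p _ (x>m ∷ R>m)) (push _) =
      reading blk eo (↭-push O [] x p) (x>m ∷ []) R>m
    inv-step (reading {S = []} {R = x ∷ R} blk _ _ _ _) (pop blocked)
      with () ← trans (sym blocked) (push-onto-increasing x (mins-increasing blk))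
    inv-step (reading {O = O} {S = y ∷ S} {R = x ∷ R} blk eo p S>m (x>m ∷ R>m)) (push _) =
      reading blk eo (↭-push O (y ∷ S) x p) (x>m ∷ S>m) R>m
    inv-step (reading {Bt = Bt} {O = O} {S = y ∷ S} {R = x ∷ R} blk eo p (_ ∷ S>m) R>m) (pop _) =
      reading blk (output-snoc (concat Bt) y eo) (↭-pop O S y p) S>m R>m
    inv-step (reading {post = _ ∷ _} {M = M} {S = y ∷ S} {R = []} blk _ _ (y>m ∷ _) _) (push allowed)
      with () ← trans (sym (push-blocked-by-132 S M (next-min-smaller (splits blk)) y>m)) allowed
    inv-step (reading {post = _ ∷ _} {Bt = Bt} {O = O} {S = y ∷ S} {R = []} blk eo p (_ ∷ S>m) R>m) (pop _) =
      reading blk (output-snoc (concat Bt) y eo) (↭-pop O S y p) S>m R>m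
    inv-step (reading {post = _ ∷ _} {S = []} {R = []} blk eo p _ _) (push _) = next-block blk eo p
    inv-step (reading {post = (m′ , _) ∷ _} {S = []} {R = []} blk _ _ _ _) (pop blocked)
      with () ← trans (sym blocked) (push-onto-increasing m′ (mins-increasing blk))
    inv-step (reading {post = []} {Bt = Bt} {O = O} {S = y ∷ S} {R = []} blk eo p (_ ∷ S>m) R>m) flush =
      reading blk (output-snoc (concat Bt) y eo) (↭-pop O S y p) S>m R>m
    inv-step (reading {post = []} {S = []} {R = []} blk eo p _ _) flush = finish blk eo p
    inv-step (flushing {Bt = Bt} {P = P} {s = y ∷ s} blocks eP eo) flush =
      flushing blocks (trans eP (sym (++-assoc P [ y ] s))) (output-snoc (concat Bt) y eo)
    inv-step (flushing blocks eP eo) halt = flushing blocks eP eo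

    run-invariant : ∀ {π} → flatten D ≡ π → ∀ j → Inv (configAt T π j)
    run-invariant D≡π j = iterate-invariant inv-step j (start (sym D≡π))

    halted-output : ∀ {c} → Inv c → Halted c →
                    ∃ λ Bt → Pointwise _↭_ Bt (map proj₂ D) × output c ≡ concat Bt ++ reverse (map proj₁ D)
    halted-output (start e) (refl , _) with D≡[] ← flatten-≡[] D e =
      [] , subst (λ Δ → Pointwise _↭_ [] (map proj₂ Δ)) (sym D≡[]) [] , sym (cong (reverse ∘ map proj₁) D≡[])
    halted-output (reading {m = m} {M = M} {S = S} _ _ _ _ _) (_ , s≡[]) with () ← ++-conicalʳ S (m ∷ M) s≡[]
    halted-output (flushing {Bt = Bt} {P = P} blocks eP eo) (_ , refl) =
      Bt , blocks , trans eo (cong (concat Bt ++_) (sym (trans eP (++-identityʳ P))))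

    out-shape : ∀ {π} → flatten D ≡ π →
                ∃ λ Bt → Pointwise _↭_ Bt (map proj₂ D) × out T π ≡ concat Bt ++ reverse (map proj₁ D)
    out-shape {π} D≡π = halted-output (run-invariant D≡π (2 * length π)) (out-halted π)

    stack-at-block-end : ∀ {pre post m B Bt M o c′} S → InBlock pre post m B Bt M → All (m <_) S →
                         flatten post ≢ [] → Step (conf (flatten post) (S ++ m ∷ M) o) c′ →
                         input c′ ≡ drop 1 (flatten post) → S ++ m ∷ M ≡ reverse (map proj₁ (take (suc (length pre)) D))
    stack-at-block-end {post = []} _ _ _ nonempty _ _ with () ← nonempty refl
    stack-at-block-end {post = _ ∷ _} {M = M} (y ∷ S) blk (y>m ∷ _) _ (push allowed) _
      with () ← trans (sym (push-blocked-by-132 S M (next-min-smaller (splits blk)) y>m)) allowed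
    stack-at-block-end {post = (_ , B′) ∷ post} (y ∷ S) _ _ _ (pop _) e with () ← x∷xs≢xs (B′ ++ flatten post) e
    stack-at-block-end {pre = pre} {post = _ ∷ _} {m} {B} [] blk _ _ _ _ = sym (begin
      reverse (map proj₁ (take (suc (length pre)) D))
        ≡⟨ cong (λ Δ → reverse (map proj₁ (take (suc (length pre)) Δ))) (splits blk) ⟩
      reverse (map proj₁ (take (suc (length pre)) (pre ++ (m , B) ∷ _)))
        ≡⟨ cong (reverse ∘ map proj₁) (take-suc-length-++ pre) ⟩
      reverse (map proj₁ (pre ++ [ (m , B) ]))
        ≡⟨ reverse-map-snoc proj₁ pre (m , B) ⟩
      m ∷ reverse (map proj₁ pre)
        ≡⟨ cong (m ∷_) (sym (earlier-mins blk)) ⟩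
      m ∷ _ ∎)
      where open ≡-Reasoning

    stack-before-min : ∀ {c c′} i → Inv c → Step c c′ → i < length D →
                       input c ≡ flatten (drop i D) → input c′ ≡ drop 1 (input c) →
                       stack c ≡ reverse (map proj₁ (take i D))
    stack-before-min zero    (start _) _ _ _ _ = refl
    stack-before-min (suc i) (start e) _ i<D e′ _ =
      ⊥-elim (<-irrefl (cong length (trans (sym e′) e)) (length-flatten-drop-decreasing D (s≤s z≤n) (<⇒≤ i<D)))
    stack-before-min i (flushing _ _ _) _ i<D e′ _ = ⊥-elim (flatten-drop-≢[] D i<D (sym e′))
    stack-before-min i (reading {pre} {O = O} {S = S} {R = R} blk _ p S>m _) st i<D e′ e″
      with block-boundary i (splits blk) (length-suffix-↭ O S R p) (<⇒≤ i<D) e′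
    ... | refl , refl = stack-at-block-end S blk S>m (λ e → flatten-drop-≢[] D i<D (trans (sym e′) e)) st e″

    stack-when-min-pushed : ∀ {π} → flatten D ≡ π → (i j : ℕ) → i < length D →
                            input (configAt T π j) ≡ flatten (drop i D) →
                            input (configAt T π (suc j)) ≡ drop 1 (flatten (drop i D)) →
                            stack (configAt T π j) ≡ reverse (map proj₁ (take i D))
    stack-when-min-pushed D≡π i j i<D e e′ =
      stack-before-min i (run-invariant D≡π j) (step-Step _) i<D e (trans e′ (cong (drop 1) (sym e)))

descent-not-increasing : ∀ ρ {a b} → a > b → ¬ Linked _<_ (ρ ++ a ∷ b ∷ [])
descent-not-increasing ρ a>b inc = <-asym (Linked-middle ρ inc) a>b

mainTheorem1 :
    (k : ℕ) → 3 ≤ k →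
    (σ : List ℕ) → IsPerm k σ →
    (ρ : List ℕ) (a b : ℕ) → σ ≡ ρ ++ a ∷ b ∷ [] → a > b →
    (n : ℕ) (π : List ℕ) → IsPerm n π →
    (D : List (ℕ × List ℕ)) → IsLTRMinDecomp π D →
    -- (1a) when m_{i+1} is pushed (step j), the stack is m_i ⋯ m_1 (top to bottom)
    ((i j : ℕ) → i < length D →
      input (configAt ((1 ∷ 3 ∷ 2 ∷ []) ∷ σ ∷ []) π j) ≡ flatten (drop i D) →
      input (configAt ((1 ∷ 3 ∷ 2 ∷ []) ∷ σ ∷ []) π (suc j)) ≡ drop 1 (flatten (drop i D)) →
      stack (configAt ((1 ∷ 3 ∷ 2 ∷ []) ∷ σ ∷ []) π j) ≡ reverse (map proj₁ (take i D)))
    ×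
    -- (1b) out^{132,σ}(π) = B̃_1 ⋯ B̃_t m_t ⋯ m_1 with B̃_i a rearrangement of B_i
    Σ (List (List ℕ)) (λ B̃ →
      Pointwise _↭_ B̃ (map proj₂ D)
      × out ((1 ∷ 3 ∷ 2 ∷ []) ∷ σ ∷ []) π ≡ concat B̃ ++ reverse (map proj₁ D)
      -- (2) if π is {132,σ}-sortable, every B̃_i is decreasing and B_i > B_{i+1}
      × (Sortable ((1 ∷ 3 ∷ 2 ∷ []) ∷ σ ∷ []) π →
          All (Linked _>_) B̃
          × Linked (λ B B′ → All (λ x → All (λ y → x > y) B′) B) (map proj₂ D)))
mainTheorem1 k 3≤k _ σ-perm [] a b refl _ _ _ _ _ _
  with s≤s (s≤s ()) ← ≤-trans 3≤k (≤-reflexive (sym (trans (↭-length σ-perm) (trans (length-map suc (upTo k)) (length-upTo k)))))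
mainTheorem1 _ _ _ _ (u ∷ ρ) a b refl a>b n π π-perm D (D≡π , mins , blocks) =
  let Bt , blocks-↭ , out≡ = out-shape D≡π in
  stack-when-min-pushed D≡π , Bt , blocks-↭ , out≡ ,
  λ sortable → sorted-out21⇒blocks-decreasing D mins blocks blocks-↭ out≡
                 (distinct-of-perm n (↭-trans (out-↭ π) π-perm)) (sortable⇒out21-sorted T π sortable)
  where
  open PatternStack u (ρ ++ a ∷ b ∷ []) (descent-not-increasing ρ a>b)
  open Run D mins blocks
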